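{- Let $F_6$ be the free group on six generators and $f\colon F_6\to\mathrm{V}$ a surjective homomorphism. If $\widetilde f,\widetilde f'\colon F_6\to\widetilde{\mathrm{V}}$ are two surjective homomorphisms lifting $f$ (i.e. whose composites with $\widetilde{\mathrm V}\to\mathrm V$ equal $f$), then there exists a unique isomorphism $\phi\colon\widetilde{\mathrm V}\to\widetilde{\mathrm V}$ such that $\widetilde f'=\phi\circ\widetilde f$.
   Context: Let $\Lambda$ be the root lattice of type $E_6$ and $\mathrm{V}=\Lambda/2\Lambda$ (an elementary abelian group of order $2^6$). Let $1\to\{\pm1\}\to\widetilde{\mathrm V}\to\mathrm V\to1$ be a central extension of groups such that for every $v\in\mathrm V$ and every lift $\widetilde v\in\widetilde{\mathrm V}$ one has $\widetilde v^2=(-1)^{(\lambda,\lambda)/2}$ where $\lambda\in\Lambda$ reduces to $v$ (such an extension exists and is unique up to isomorphism of central extensions). -}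

module Defs where

open import Level using (Level; _⊔_) renaming (zero to 0ℓ)
open import Data.Nat as ℕ using (ℕ; zero; suc)
open import Data.Integer as ℤ using (ℤ; +_; -_; _+_; _-_; _*_; ∣_∣)
open import Data.Integer.Divisibility using (_∣_)
open import Data.Integer.DivMod using (_/_)
open import Data.Fin using (Fin)
open import Data.Bool using (Bool; true; false; not)
open import Data.Product using (Σ; ∃; _×_; _,_)
open import Data.List using (List; []; _∷_; _++_; reverse; map)
open import Data.Sign as Sign using (Sign)
open import Data.Sign.Properties using (*-group)
open import Function using (_⇔_)
open import Function.Definitions using (Surjective)
open import Relation.Binary.PropositionalEquality using (_≡_)
open import Algebra.Bundles using (Group)
open import Algebra.Bundles.Raw using (RawGroup)
open import Algebra.Morphism.Structures using (module GroupMorphisms)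

-- The root lattice Λ of type E6.
-- Elements are integer coordinate vectors w.r.t. the basis of simple
-- roots α₀,…,α₅; Dynkin diagram (Bourbaki numbering shifted by one):
--   α₀ - α₂ - α₃ - α₄ - α₅   with α₁ attached to α₃.
-- The inner product is given by the Cartan (= Gram) matrix.

Λ : Set
Λ = Fin 6 → ℤ

cartan : Fin 6 → Fin 6 → ℤ
cartan i j = go (Data.Fin.toℕ i) (Data.Fin.toℕ j)
  where
  edge : ℕ → ℕ → Bool
  edge 0 2 = true
  edge 2 0 = true
  edge 1 3 = true
  edge 3 1 = true
  edge 2 3 = true
  edge 3 2 = true
  edge 3 4 = true
  edge 4 3 = true
  edge 4 5 = true
  edge 5 4 = true
  edge _ _ = false
  go : ℕ → ℕ → ℤ
  go m n with m ℕ.≡ᵇ n | edge m n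
  ... | true  | _     = + 2
  ... | false | true  = - (+ 1)
  ... | false | false = + 0

Σ₆ : (Fin 6 → ℤ) → ℤ
Σ₆ f = f f0 + f f1 + f f2 + f f3 + f f4 + f f5
  where
  f0 f1 f2 f3 f4 f5 : Fin 6
  f0 = Data.Fin.zero
  f1 = Data.Fin.suc Data.Fin.zero
  f2 = Data.Fin.suc (Data.Fin.suc Data.Fin.zero)
  f3 = Data.Fin.suc (Data.Fin.suc (Data.Fin.suc Data.Fin.zero))
  f4 = Data.Fin.suc (Data.Fin.suc (Data.Fin.suc (Data.Fin.suc Data.Fin.zero)))
  f5 = Data.Fin.fromℕ 5

⟨_,_⟩ : Λ → Λ → ℤ
⟨ λ′ , μ ⟩ = Σ₆ (λ i → Σ₆ (λ j → cartan i j * λ′ i * μ j))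

-- (λ,λ)/2  (exact division: the lattice is even)
halfNorm : Λ → ℤ
halfNorm x = ⟨ x , x ⟩ / + 2

-- V = Λ / 2Λ, as a group whose equality is congruence modulo 2Λ.

_≈V_ : Λ → Λ → Set
x ≈V y = ∀ i → (+ 2) ∣ (x i - y i)

V : RawGroup 0ℓ 0ℓ
V = record
  { Carrier = Λ
  ; _≈_     = _≈V_
  ; _∙_     = λ x y i → x i + y i
  ; ε       = λ _ → + 0
  ; _⁻¹     = λ x i → - (x i)
  }

-- the reduction map Λ → V is the identity on representatives, so
-- "λ reduces to v" means  λ ≈V v.

±1 : Group 0ℓ 0ℓ
±1 = *-group

[-1]^ : ℕ → Sign
[-1]^ zero    = Sign.+
[-1]^ (suc n) = Sign.- Sign.* [-1]^ n

[-1]^ℤ : ℤ → Sign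
[-1]^ℤ z = [-1]^ ∣ z ∣

-- The free group F₆ on six generators: words in the letters
-- g_i^{±1} (Bool = "is inverted") modulo free reduction.

Letter : Set
Letter = Fin 6 × Bool

invL : Letter → Letter
invL (i , b) = (i , not b)

Word : Set
Word = List Letter

data _~_ : Word → Word → Set where
  ~refl   : ∀ {u} → u ~ u
  ~sym    : ∀ {u v} → u ~ v → v ~ u
  ~trans  : ∀ {u v w} → u ~ v → v ~ w → u ~ w
  ~cancel : ∀ u a v → (u ++ a ∷ invL a ∷ v) ~ (u ++ v)

F₆ : RawGroup 0ℓ 0ℓ
F₆ = record
  { Carrier = Word
  ; _≈_     = _~_
  ; _∙_     = _++_
  ; ε       = []
  ; _⁻¹     = λ w → reverse (map invL w)
  }

module _ {a b ℓ₁ ℓ₂ : Level} (G : RawGroup a ℓ₁) (H : RawGroup b ℓ₂) where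
  open GroupMorphisms G H
  IsHom : (RawGroup.Carrier G → RawGroup.Carrier H) → Set (a ⊔ ℓ₁ ⊔ ℓ₂)
  IsHom = IsGroupHomomorphism
  IsIso : (RawGroup.Carrier G → RawGroup.Carrier H) → Set (a ⊔ b ⊔ ℓ₁ ⊔ ℓ₂)
  IsIso = IsGroupIsomorphism
  IsSurj : (RawGroup.Carrier G → RawGroup.Carrier H) → Set (a ⊔ b ⊔ ℓ₁ ⊔ ℓ₂)
  IsSurj = Surjective (RawGroup._≈_ G) (RawGroup._≈_ H)

record IsExtension {c ℓ : Level} (Ṽ : Group c ℓ)
         (ι : Sign → Group.Carrier Ṽ) (π : Group.Carrier Ṽ → Λ)
         : Set (c ⊔ ℓ) where
  open Group Ṽ
  field
    ι-hom     : IsHom (Group.rawGroup ±1) rawGroup ι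
    ι-inj     : ∀ s t → ι s ≈ ι t → s ≡ t
    ι-central : ∀ s x → ι s ∙ x ≈ x ∙ ι s
    π-hom     : IsHom rawGroup V π
    π-surj    : IsSurj rawGroup V π
    exact     : ∀ x → (π x ≈V RawGroup.ε V) ⇔ (∃ λ s → ι s ≈ x)
    square    : ∀ (v : Λ) (ṽ : Carrier) → π ṽ ≈V v →
                ∀ (λ′ : Λ) → λ′ ≈V v → ṽ ∙ ṽ ≈ ι ([-1]^ℤ (halfNorm λ′))

{-# OPTIONS --safe #-}
module Submission where

-- Since V is elementary abelian of order 2⁶, f w is the sum of the images of those generators
-- occurring an odd number of times in w. Surjectivity of f makes this map (ℤ/2)⁶ → V onto,
-- hence injective by counting, so f w = 0 forces every generator to occur in w an even number
-- of times. Two lifts of f differ on each generator gᵢ by a central sign sᵢ, so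
-- f̃′ w = f̃ w · ι(∏ sᵢ^(number of gᵢ^±1 in w)), and the kernel of f̃ lies in that of f̃′ (and
-- symmetrically). Surjections with equal kernels differ by a unique isomorphism φ = f̃′ ∘ f̃⁻¹.

open import Defs
open import Level using (Level) renaming (zero to 0ℓ)
open import Algebra.Bundles using (Group; AbelianGroup)
open import Algebra.Bundles.Raw using (RawGroup)
import Algebra.Morphism.Construct.Identity as Identity
open import Algebra.Morphism.Structures using (module GroupMorphisms)
open import Data.Bool using (Bool; true; false; not; if_then_else_)
open import Data.Fin as Fin using (Fin; punchOut)
open import Data.Fin.Properties using (any?; _≟_; punchOut-injective; injective⇒≤; 2↔Bool)
open import Data.Integer using (ℤ; +_; -_; _+_; _-_; _*_)
open import Data.Integer.Divisibility using (_∣_)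
import Data.Integer.Divisibility.Signed as Signed
import Data.Integer.Properties as ℤ
open import Data.Integer.Tactic.RingSolver using (solve-∀)
open import Data.List using ([]; _∷_)
open import Data.Nat as ℕ using (_^_)
open import Data.Nat.Divisibility using (∣1⇒≡1)
open import Data.Nat.Properties using (1+n≰n)
open import Data.Product using (Σ; ∃; _×_; _,_; proj₁; proj₂)
open import Data.Sign as Sign using (Sign)
open import Data.Sign.Properties using (*-abelianGroup; s*s≡+)
open import Data.Vec using (Vec; []; _∷_; replicate; lookup; _[_]%=_)
import Data.Vec.Functional.Relation.Binary.Pointwise.Properties as Pointwise
open import Data.Vec.Recursive using (lift↔; Fin[m^n]↔Fin[m]^n)
open import Data.Vec.Recursive.Properties using (↔Vec)
open import Function using (_∘_; _↔_; Inverse; Injection; Equivalence)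
open import Function.Definitions using (Injective; StrictlySurjective)
open import Function.Properties.Inverse using (↔-trans; ↔-sym; ↔⇒↣)
open import Relation.Binary.Bundles using (Setoid)
open import Relation.Binary.Definitions using (Reflexive)
import Relation.Binary.Reasoning.Setoid as SetoidReasoning
open import Relation.Binary.PropositionalEquality as ≡ using (_≡_; _≢_; module ≡-Reasoning)
open import Relation.Binary.Structures using (IsEquivalence)
open import Relation.Nullary using (yes; no; contradiction)

Fin-injective⇒strictlySurjective : ∀ {n} {g : Fin n → Fin n} →
                                   Injective _≡_ _≡_ g → StrictlySurjective _≡_ g
Fin-injective⇒strictlySurjective {ℕ.zero} _ ()
Fin-injective⇒strictlySurjective {ℕ.suc n} {g} g-inj y with any? (λ x → g x ≟ y)
... | yes hit = hit
... | no ¬hit = contradiction (injective⇒≤ punchOut∘g-injective) (1+n≰n {n})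
  where
  y≢g : ∀ x → y ≢ g x
  y≢g x y≡gx = ¬hit (x , ≡.sym y≡gx)
  punchOut∘g-injective : Injective _≡_ _≡_ (λ x → punchOut (y≢g x))
  punchOut∘g-injective eq = g-inj (punchOut-injective (y≢g _) (y≢g _) eq)

module _ {a} {A : Set a} {n} (A↔Fin : A ↔ Fin n) where
  open Inverse A↔Fin using (to; from; strictlyInverseʳ)

  private
    conjugate-injective : {g : A → A} → Injective _≡_ _≡_ g → Injective _≡_ _≡_ (to ∘ g ∘ from)
    conjugate-injective g-inj =
      Injection.injective (↔⇒↣ (↔-sym A↔Fin)) ∘ g-inj ∘ Injection.injective (↔⇒↣ A↔Fin)

  finite-injective⇒strictlySurjective : {g : A → A} →
                                        Injective _≡_ _≡_ g → StrictlySurjective _≡_ g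
  finite-injective⇒strictlySurjective {g} g-inj y
    with k , gk≡y ← Fin-injective⇒strictlySurjective (conjugate-injective g-inj) (to y)
    = from k , (begin
      g (from k)             ≡⟨ strictlyInverseʳ (g (from k)) ⟨
      from (to (g (from k))) ≡⟨ ≡.cong from gk≡y ⟩
      from (to y)            ≡⟨ strictlyInverseʳ y ⟩
      y                      ∎)
    where open ≡-Reasoning

  module _ {s ℓ} (S : Setoid s ℓ) where
    open Setoid S using (Carrier; _≈_)

    -- Choosing x with E x ≈ B y for each y gives an injection A → A, which is onto as A is finite.
    covers-injection⇒injective : (E B : A → Carrier) →
      (∀ {y y′} → B y ≈ B y′ → y ≡ y′) → (∀ y → ∃ λ x → E x ≈ B y) →
      ∀ {x x′} → E x ≈ E x′ → x ≡ x′
    covers-injection⇒injective E B B-injective E-covers-B {x} {x′} Ex≈Ex′ =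
      ≡.trans (≡.sym (R∘R⁻¹ x)) (≡.trans (≡.cong R (B-injective B[R⁻¹x]≈B[R⁻¹x′])) (R∘R⁻¹ x′))
      where
      open SetoidReasoning S
      R : A → A
      R y = proj₁ (E-covers-B y)
      ER≈B : ∀ y → E (R y) ≈ B y
      ER≈B y = proj₂ (E-covers-B y)
      R-injective : Injective _≡_ _≡_ R
      R-injective {y} {y′} Ry≡Ry′ = B-injective (begin
        B y       ≈⟨ ER≈B y ⟨
        E (R y)   ≡⟨ ≡.cong E Ry≡Ry′ ⟩
        E (R y′)  ≈⟨ ER≈B y′ ⟩
        B y′      ∎)
      R⁻¹ : A → A
      R⁻¹ x = proj₁ (finite-injective⇒strictlySurjective R-injective x)
      R∘R⁻¹ : ∀ x → R (R⁻¹ x) ≡ x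
      R∘R⁻¹ x = proj₂ (finite-injective⇒strictlySurjective R-injective x)
      B[R⁻¹x]≈B[R⁻¹x′] : B (R⁻¹ x) ≈ B (R⁻¹ x′)
      B[R⁻¹x]≈B[R⁻¹x′] = begin
        B (R⁻¹ x)       ≈⟨ ER≈B (R⁻¹ x) ⟨
        E (R (R⁻¹ x))   ≡⟨ ≡.cong E (R∘R⁻¹ x) ⟩
        E x             ≈⟨ Ex≈Ex′ ⟩
        E x′            ≡⟨ ≡.cong E (R∘R⁻¹ x′) ⟨
        E (R (R⁻¹ x′))  ≈⟨ ER≈B (R⁻¹ x′) ⟩
        B (R⁻¹ x′)      ∎

Vec-Bool↔Fin : ∀ n → Vec Bool n ↔ Fin (2 ^ n)
Vec-Bool↔Fin n = ↔-trans (↔-sym (↔Vec n))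
                  (↔-trans (lift↔ n (↔-sym 2↔Bool)) (↔-sym (Fin[m^n]↔Fin[m]^n 2 n)))

module BitVectorEvaluation {c ℓ} (M : AbelianGroup c ℓ) where
  open AbelianGroup M
  open import Algebra.Properties.CommutativeSemigroup commutativeSemigroup using (x∙yz≈y∙xz)
  open SetoidReasoning setoid

  ⟦_⟧ : ∀ {n} → Vec Bool n → (Fin n → Carrier) → Carrier
  ⟦ [] ⟧ a = ε
  ⟦ b ∷ x ⟧ a = (if b then a Fin.zero else ε) ∙ ⟦ x ⟧ (a ∘ Fin.suc)

  ⟦replicate-false⟧ : ∀ n a → ⟦ replicate n false ⟧ a ≈ ε
  ⟦replicate-false⟧ ℕ.zero a = refl
  ⟦replicate-false⟧ (ℕ.suc n) a = trans (identityˡ _) (⟦replicate-false⟧ n (a ∘ Fin.suc))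

  module _ (exponent-2 : ∀ u → u ∙ u ≈ ε) where

    ⟦flip⟧ : ∀ {n} (i : Fin n) x a → ⟦ x [ i ]%= not ⟧ a ≈ a i ∙ ⟦ x ⟧ a
    ⟦flip⟧ Fin.zero (false ∷ x) a = ∙-congˡ (sym (identityˡ _))
    ⟦flip⟧ {ℕ.suc n} Fin.zero (true ∷ x) a = begin
      ε ∙ ⟦ x ⟧ a′             ≈⟨ ∙-congʳ (exponent-2 a₀) ⟨
      (a₀ ∙ a₀) ∙ ⟦ x ⟧ a′     ≈⟨ assoc a₀ a₀ _ ⟩
      a₀ ∙ (a₀ ∙ ⟦ x ⟧ a′)     ∎
      where
      a₀ : Carrier
      a₀ = a Fin.zero
      a′ : Fin n → Carrier
      a′ = a ∘ Fin.suc
    ⟦flip⟧ {ℕ.suc n} (Fin.suc i) (b ∷ x) a = begin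
      aᵇ ∙ ⟦ x [ i ]%= not ⟧ a′    ≈⟨ ∙-congˡ (⟦flip⟧ i x a′) ⟩
      aᵇ ∙ (a′ i ∙ ⟦ x ⟧ a′)       ≈⟨ x∙yz≈y∙xz aᵇ (a′ i) _ ⟩
      a′ i ∙ (aᵇ ∙ ⟦ x ⟧ a′)       ∎
      where
      aᵇ : Carrier
      aᵇ = if b then a Fin.zero else ε
      a′ : Fin n → Carrier
      a′ = a ∘ Fin.suc

infix 4 _≡₂_
_≡₂_ : ℤ → ℤ → Set
x ≡₂ y = (+ 2) ∣ (x - y)

-- The divisibility in _≡₂_ is that of absolute values, from which Agda cannot
-- recover x and y; hence the explicit arguments below.
private
  2∣-by : ∀ {d e} → d ≡ e → + 2 Signed.∣ e → (+ 2) ∣ d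
  2∣-by ≡.refl = Signed.∣⇒∣ᵤ

  2∣-difference : ∀ x y → x ≡₂ y → + 2 Signed.∣ x - y
  2∣-difference x y = Signed.∣ᵤ⇒∣

≡₂-reflexive : ∀ {x y} → x ≡ y → x ≡₂ y
≡₂-reflexive {x} ≡.refl = 2∣-by (ℤ.+-inverseʳ x) (Signed.divides (+ 0) ≡.refl)

≡₂-sym : ∀ x y → x ≡₂ y → y ≡₂ x
≡₂-sym x y x≡₂y = 2∣-by (difference-swap x y) (Signed.∣m⇒∣-m (2∣-difference x y x≡₂y))
  where
  difference-swap : ∀ x y → y - x ≡ - (x - y)
  difference-swap = solve-∀

≡₂-trans : ∀ x y z → x ≡₂ y → y ≡₂ z → x ≡₂ z
≡₂-trans x y z x≡₂y y≡₂z = 2∣-by (difference-split x y z)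
  (Signed.∣m∣n⇒∣m+n (2∣-difference x y x≡₂y) (2∣-difference y z y≡₂z))
  where
  difference-split : ∀ x y z → x - z ≡ (x - y) + (y - z)
  difference-split = solve-∀

≡₂-isEquivalence : IsEquivalence _≡₂_
≡₂-isEquivalence = record
  { refl = λ {x} → ≡₂-reflexive {x} ≡.refl
  ; sym = λ {x} {y} → ≡₂-sym x y
  ; trans = λ {x} {y} {z} → ≡₂-trans x y z
  }

+-cong-≡₂ : ∀ x y u v → x ≡₂ y → u ≡₂ v → x + u ≡₂ y + v
+-cong-≡₂ x y u v x≡₂y u≡₂v = 2∣-by (difference-+ x y u v)
  (Signed.∣m∣n⇒∣m+n (2∣-difference x y x≡₂y) (2∣-difference u v u≡₂v))
  where
  difference-+ : ∀ x y u v → (x + u) - (y + v) ≡ (x - y) + (u - v)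
  difference-+ = solve-∀

-‿cong-≡₂ : ∀ x y → x ≡₂ y → - x ≡₂ - y
-‿cong-≡₂ x y x≡₂y = 2∣-by (difference-neg x y) (Signed.∣m⇒∣-m (2∣-difference x y x≡₂y))
  where
  difference-neg : ∀ x y → - x - - y ≡ - (x - y)
  difference-neg = solve-∀

x+x≡₂0 : ∀ x → x + x ≡₂ + 0
x+x≡₂0 x = 2∣-by (double x) (Signed.divides x ≡.refl)
  where
  double : ∀ x → x + x - + 0 ≡ x * + 2
  double = solve-∀

-- Built from the operations of V itself, so that homomorphisms into V are homomorphisms into Λ/2Λ.
Λ/2Λ : AbelianGroup 0ℓ 0ℓ
Λ/2Λ = record
  { Carrier = Λ
  ; _≈_ = _≈V_
  ; _∙_ = RawGroup._∙_ V
  ; ε = RawGroup.ε V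
  ; _⁻¹ = RawGroup._⁻¹ V
  ; isAbelianGroup = record
    { isGroup = record
      { isMonoid = record
        { isSemigroup = record
          { isMagma = record
            { isEquivalence = Pointwise.isEquivalence ≡₂-isEquivalence 6
            ; ∙-cong = λ {x} {y} {u} {v} x≈y u≈v i →
                         +-cong-≡₂ (x i) (y i) (u i) (v i) (x≈y i) (u≈v i)
            }
          ; assoc = λ x y z i → ≡₂-reflexive (ℤ.+-assoc (x i) (y i) (z i))
          }
        ; identity = (λ x i → ≡₂-reflexive (ℤ.+-identityˡ (x i)))
                   , (λ x i → ≡₂-reflexive (ℤ.+-identityʳ (x i)))
        }
      ; inverse = (λ x i → ≡₂-reflexive (ℤ.+-inverseˡ (x i)))
                , (λ x i → ≡₂-reflexive (ℤ.+-inverseʳ (x i)))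
      ; ⁻¹-cong = λ {x} {y} x≈y i → -‿cong-≡₂ (x i) (y i) (x≈y i)
      }
    ; comm = λ x y i → ≡₂-reflexive (ℤ.+-comm (x i) (y i))
    }
  }

Λ/2Λ-exponent-2 : ∀ (x : Λ) → (λ i → x i + x i) ≈V (λ _ → + 0)
Λ/2Λ-exponent-2 x i = x+x≡₂0 (x i)

bits : ∀ {n} → Vec Bool n → Fin n → ℤ
bits x i = if lookup x i then + 1 else + 0

bits-injective : ∀ {n} (x y : Vec Bool n) → (∀ i → bits x i ≡₂ bits y i) → x ≡ y
bits-injective [] [] _ = ≡.refl
bits-injective (a ∷ x) (b ∷ y) bx≡₂by =
  ≡.cong₂ _∷_ (bit-injective a b (bx≡₂by Fin.zero)) (bits-injective x y (bx≡₂by ∘ Fin.suc))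
  where
  bit-injective : ∀ a b → bits (a ∷ []) Fin.zero ≡₂ bits (b ∷ []) Fin.zero → a ≡ b
  bit-injective false false _ = ≡.refl
  bit-injective true true _ = ≡.refl
  bit-injective false true 2∣1 with () ← ∣1⇒≡1 2∣1
  bit-injective true false 2∣1 with () ← ∣1⇒≡1 2∣1

generator : Fin 6 → Word
generator i = (i , false) ∷ []

parity : Word → Vec Bool 6
parity [] = replicate 6 false
parity ((i , _) ∷ w) = parity w [ i ]%= not

module _ {c ℓ c′ ℓ′} (G : Group c ℓ) (M : AbelianGroup c′ ℓ′) where
  open Group G
  open import Algebra.Properties.Group G using (⁻¹-anti-homo-∙)
  open SetoidReasoning setoid
  open BitVectorEvaluation M using (⟦_⟧; ⟦replicate-false⟧; ⟦flip⟧)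
  private
    module M = AbelianGroup M

  module _ (exponent-2 : ∀ u → u M.∙ u M.≈ M.ε)
           {ι : M.Carrier → Carrier} (ι-hom : IsHom M.rawGroup rawGroup ι)
           (ι-central : ∀ u x → ι u ∙ x ≈ x ∙ ι u)
           {h h′ : Word → Carrier} (h-hom : IsHom F₆ rawGroup h) (h′-hom : IsHom F₆ rawGroup h′)
           (t : Fin 6 → M.Carrier)
           (twist-on-generators : ∀ i → h′ (generator i) ≈ h (generator i) ∙ ι (t i)) where
    private
      module ι = GroupMorphisms.IsGroupHomomorphism ι-hom
      module h = GroupMorphisms.IsGroupHomomorphism h-hom
      module h′ = GroupMorphisms.IsGroupHomomorphism h′-hom

    twist-on-letters : ∀ i b → h′ ((i , b) ∷ []) ≈ h ((i , b) ∷ []) ∙ ι (t i)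
    twist-on-letters i false = twist-on-generators i
    twist-on-letters i true = begin
      h′ ((i , true) ∷ [])              ≈⟨ h′.⁻¹-homo (generator i) ⟩
      h′ (generator i) ⁻¹               ≈⟨ ⁻¹-cong (twist-on-generators i) ⟩
      (h (generator i) ∙ ι (t i)) ⁻¹    ≈⟨ ⁻¹-anti-homo-∙ (h (generator i)) (ι (t i)) ⟩
      ι (t i) ⁻¹ ∙ h (generator i) ⁻¹   ≈⟨ ∙-congʳ (ι.⁻¹-homo (t i)) ⟨
      ι (t i M.⁻¹) ∙ h (generator i) ⁻¹ ≈⟨ ∙-congʳ (ι.⟦⟧-cong t⁻¹≈t) ⟩
      ι (t i) ∙ h (generator i) ⁻¹      ≈⟨ ι-central (t i) _ ⟩
      h (generator i) ⁻¹ ∙ ι (t i)      ≈⟨ ∙-congʳ (h.⁻¹-homo (generator i)) ⟨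
      h ((i , true) ∷ []) ∙ ι (t i)     ∎
      where
      open import Algebra.Properties.Group M.group using (inverseˡ-unique)
      t⁻¹≈t : t i M.⁻¹ M.≈ t i
      t⁻¹≈t = M.sym (inverseˡ-unique (t i) (t i) (exponent-2 (t i)))

    central-interchange : ∀ x u y v → (x ∙ ι u) ∙ (y ∙ v) ≈ (x ∙ y) ∙ (ι u ∙ v)
    central-interchange x u y v = begin
      (x ∙ ι u) ∙ (y ∙ v)  ≈⟨ assoc x (ι u) (y ∙ v) ⟩
      x ∙ (ι u ∙ (y ∙ v))  ≈⟨ ∙-congˡ (assoc (ι u) y v) ⟨
      x ∙ ((ι u ∙ y) ∙ v)  ≈⟨ ∙-congˡ (∙-congʳ (ι-central u y)) ⟩
      x ∙ ((y ∙ ι u) ∙ v)  ≈⟨ ∙-congˡ (assoc y (ι u) v) ⟩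
      x ∙ (y ∙ (ι u ∙ v))  ≈⟨ assoc x y (ι u ∙ v) ⟨
      (x ∙ y) ∙ (ι u ∙ v)  ∎

    twist-by-parity : ∀ w → h′ w ≈ h w ∙ ι (⟦ parity w ⟧ t)
    twist-by-parity [] = begin
      h′ []                       ≈⟨ h′.ε-homo ⟩
      ε                           ≈⟨ identityʳ ε ⟨
      ε ∙ ε                       ≈⟨ ∙-cong h.ε-homo (trans (ι.⟦⟧-cong (⟦replicate-false⟧ 6 t)) ι.ε-homo) ⟨
      h [] ∙ ι (⟦ parity [] ⟧ t)  ∎
    twist-by-parity ((i , b) ∷ w) = begin
      h′ (a ∷ w)                                  ≈⟨ h′.homo (a ∷ []) w ⟩
      h′ (a ∷ []) ∙ h′ w                          ≈⟨ ∙-cong (twist-on-letters i b) (twist-by-parity w) ⟩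
      (h (a ∷ []) ∙ ι (t i)) ∙ (h w ∙ ι ⟦w⟧)      ≈⟨ central-interchange _ (t i) _ _ ⟩
      (h (a ∷ []) ∙ h w) ∙ (ι (t i) ∙ ι ⟦w⟧)      ≈⟨ ∙-cong (h.homo (a ∷ []) w) (ι.homo (t i) ⟦w⟧) ⟨
      h (a ∷ w) ∙ ι (t i M.∙ ⟦w⟧)                 ≈⟨ ∙-congˡ (ι.⟦⟧-cong (⟦flip⟧ exponent-2 i (parity w) t)) ⟨
      h (a ∷ w) ∙ ι (⟦ parity (a ∷ w) ⟧ t)        ∎
      where
      a : Letter
      a = (i , b)
      ⟦w⟧ : M.Carrier
      ⟦w⟧ = ⟦ parity w ⟧ t

module _ {c ℓ} (M : AbelianGroup c ℓ) where
  open AbelianGroup M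
  open BitVectorEvaluation M using (⟦_⟧)
  open import Algebra.Properties.Group group using (ε⁻¹≈ε)

  hom-via-parity : (∀ u → u ∙ u ≈ ε) → {d : Word → Carrier} → IsHom F₆ rawGroup d →
                   ∀ w → d w ≈ ⟦ parity w ⟧ (d ∘ generator)
  hom-via-parity exponent-2 {d} d-hom w = trans
    (twist-by-parity group M exponent-2
      (Identity.isGroupHomomorphism rawGroup refl) comm trivial-hom d-hom
      (d ∘ generator) (λ i → sym (identityˡ _)) w)
    (identityˡ _)
    where
    trivial-hom : IsHom F₆ rawGroup (λ _ → ε)
    trivial-hom = record
      { isMonoidHomomorphism = record
        { isMagmaHomomorphism = record
          { isRelHomomorphism = record { cong = λ _ → refl }
          ; homo = λ _ _ → sym (identityˡ ε)
          }
        ; ε-homo = refl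
        }
      ; ⁻¹-homo = λ _ → sym ε⁻¹≈ε
      }

module _ {f : Word → Λ} (f-hom : IsHom F₆ V f) (f-surj : IsSurj F₆ V f) where
  open AbelianGroup Λ/2Λ using (setoid)
  open BitVectorEvaluation Λ/2Λ using (⟦_⟧; ⟦replicate-false⟧)
  open SetoidReasoning setoid

  evaluation-on-generators-injective : ∀ {x y} →
    ⟦ x ⟧ (f ∘ generator) ≈V ⟦ y ⟧ (f ∘ generator) → x ≡ y
  evaluation-on-generators-injective =
    covers-injection⇒injective (Vec-Bool↔Fin 6) setoid (λ x → ⟦ x ⟧ (f ∘ generator)) bits
      (λ {y} {y′} → bits-injective y y′) covers-bits
    where
    covers-bits : ∀ y → ∃ λ x → ⟦ x ⟧ (f ∘ generator) ≈V bits y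
    covers-bits y = parity w , (begin
      ⟦ parity w ⟧ (f ∘ generator)  ≈⟨ hom-via-parity Λ/2Λ Λ/2Λ-exponent-2 f-hom w ⟨
      f w                           ≈⟨ proj₂ (f-surj (bits y)) ~refl ⟩
      bits y                        ∎)
      where
      w : Word
      w = proj₁ (f-surj (bits y))

  parity-vanishes-on-kernel : ∀ w → f w ≈V (λ _ → + 0) → parity w ≡ replicate 6 false
  parity-vanishes-on-kernel w fw≈0 = evaluation-on-generators-injective (begin
    ⟦ parity w ⟧ (f ∘ generator)               ≈⟨ hom-via-parity Λ/2Λ Λ/2Λ-exponent-2 f-hom w ⟨
    f w                                        ≈⟨ fw≈0 ⟩
    (λ _ → + 0)                                ≈⟨ ⟦replicate-false⟧ 6 (f ∘ generator) ⟨
    ⟦ replicate 6 false ⟧ (f ∘ generator)      ∎)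

module _ {a ℓa c ℓ} {A : RawGroup a ℓa} (G : Group c ℓ) where
  open Group G
  private
    module A = RawGroup A
  open import Algebra.Properties.Group G using (x∙y⁻¹≈ε⇒x≈y; x≈y⇒x∙y⁻¹≈ε)
  open SetoidReasoning setoid

  equal-images⇒x∙y⁻¹∈kernel : {h : A.Carrier → Carrier} → IsHom A rawGroup h →
    ∀ x y → h x ≈ h y → h (x A.∙ y A.⁻¹) ≈ ε
  equal-images⇒x∙y⁻¹∈kernel {h} h-hom x y hx≈hy = begin
    h (x A.∙ y A.⁻¹)   ≈⟨ h.homo x (y A.⁻¹) ⟩
    h x ∙ h (y A.⁻¹)   ≈⟨ ∙-congˡ (h.⁻¹-homo y) ⟩
    h x ∙ h y ⁻¹       ≈⟨ x≈y⇒x∙y⁻¹≈ε hx≈hy ⟩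
    ε                  ∎
    where
    module h = GroupMorphisms.IsGroupHomomorphism h-hom

  kernel⊆⇒respects : {h h′ : A.Carrier → Carrier} →
    IsHom A rawGroup h → IsHom A rawGroup h′ →
    (∀ w → h w ≈ ε → h′ w ≈ ε) → ∀ u v → h u ≈ h v → h′ u ≈ h′ v
  kernel⊆⇒respects {h} {h′} h-hom h′-hom ker⊆ u v hu≈hv = x∙y⁻¹≈ε⇒x≈y (h′ u) (h′ v) (begin
    h′ u ∙ h′ v ⁻¹        ≈⟨ ∙-congˡ (h′.⁻¹-homo v) ⟨
    h′ u ∙ h′ (v A.⁻¹)    ≈⟨ h′.homo u (v A.⁻¹) ⟨
    h′ (u A.∙ v A.⁻¹)     ≈⟨ ker⊆ (u A.∙ v A.⁻¹) (equal-images⇒x∙y⁻¹∈kernel h-hom u v hu≈hv) ⟩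
    ε                     ∎)
    where
    module h′ = GroupMorphisms.IsGroupHomomorphism h′-hom

  module Factorisation (A-refl : Reflexive A._≈_) {h h′ : A.Carrier → Carrier}
                       (h-hom : IsHom A rawGroup h) (h-surj : IsSurj A rawGroup h)
                       (h′-hom : IsHom A rawGroup h′) (ker⊆ : ∀ w → h w ≈ ε → h′ w ≈ ε) where
    private
      module h = GroupMorphisms.IsGroupHomomorphism h-hom
      module h′ = GroupMorphisms.IsGroupHomomorphism h′-hom

    section : Carrier → A.Carrier
    section x = proj₁ (h-surj x)

    h∘section : ∀ x → h (section x) ≈ x
    h∘section x = proj₂ (h-surj x) A-refl

    φ : Carrier → Carrier
    φ x = h′ (section x)

    φ-preimage : ∀ x w → h w ≈ x → φ x ≈ h′ w
    φ-preimage x w hw≈x =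
      kernel⊆⇒respects h-hom h′-hom ker⊆ (section x) w (trans (h∘section x) (sym hw≈x))

    φ-homo : ∀ x y → φ (x ∙ y) ≈ φ x ∙ φ y
    φ-homo x y = trans (φ-preimage (x ∙ y) (section x A.∙ section y) (begin
      h (section x A.∙ section y)    ≈⟨ h.homo (section x) (section y) ⟩
      h (section x) ∙ h (section y)  ≈⟨ ∙-cong (h∘section x) (h∘section y) ⟩
      x ∙ y                          ∎))
      (h′.homo (section x) (section y))

    φ-⁻¹-homo : ∀ x → φ (x ⁻¹) ≈ φ x ⁻¹
    φ-⁻¹-homo x = trans
      (φ-preimage (x ⁻¹) (section x A.⁻¹) (trans (h.⁻¹-homo (section x)) (⁻¹-cong (h∘section x))))
      (h′.⁻¹-homo (section x))

    φ-isHom : IsHom rawGroup rawGroup φ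
    φ-isHom = record
      { isMonoidHomomorphism = record
        { isMagmaHomomorphism = record
          { isRelHomomorphism = record
            { cong = λ {x} {y} x≈y → φ-preimage x (section y) (trans (h∘section y) (sym x≈y)) }
          ; homo = φ-homo
          }
        ; ε-homo = trans (φ-preimage ε A.ε h.ε-homo) h′.ε-homo
        }
      ; ⁻¹-homo = φ-⁻¹-homo
      }

    φ-injective : (∀ w → h′ w ≈ ε → h w ≈ ε) → ∀ {x y} → φ x ≈ φ y → x ≈ y
    φ-injective ker⊇ {x} {y} φx≈φy = begin
      x              ≈⟨ h∘section x ⟨
      h (section x)  ≈⟨ kernel⊆⇒respects h′-hom h-hom ker⊇ (section x) (section y) φx≈φy ⟩
      h (section y)  ≈⟨ h∘section y ⟩
      y              ∎

    φ-surjective : IsSurj A rawGroup h′ → IsSurj rawGroup rawGroup φ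
    φ-surjective h′-surj y = h w , λ {z} z≈hw → trans (φ-preimage z w (sym z≈hw)) (proj₂ (h′-surj y) A-refl)
      where
      w : A.Carrier
      w = proj₁ (h′-surj y)

    h′≈φ∘h : ∀ w → h′ w ≈ φ (h w)
    h′≈φ∘h w = sym (φ-preimage (h w) w refl)

    φ-unique : ∀ ψ → IsHom rawGroup rawGroup ψ → (∀ w → h′ w ≈ ψ (h w)) → ∀ x → ψ x ≈ φ x
    φ-unique ψ ψ-hom h′≈ψ∘h x = begin
      ψ x               ≈⟨ GroupMorphisms.IsGroupHomomorphism.⟦⟧-cong ψ-hom (h∘section x) ⟨
      ψ (h (section x)) ≈⟨ h′≈ψ∘h (section x) ⟨
      φ x               ∎

  equal-kernels⇒unique-isomorphism : Reflexive A._≈_ → {h h′ : A.Carrier → Carrier} →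
    IsHom A rawGroup h → IsSurj A rawGroup h →
    IsHom A rawGroup h′ → IsSurj A rawGroup h′ →
    (∀ w → h w ≈ ε → h′ w ≈ ε) → (∀ w → h′ w ≈ ε → h w ≈ ε) →
    Σ (Carrier → Carrier) λ φ →
      IsIso rawGroup rawGroup φ
      × (∀ w → h′ w ≈ φ (h w))
      × (∀ ψ → IsIso rawGroup rawGroup ψ → (∀ w → h′ w ≈ ψ (h w)) → ∀ x → ψ x ≈ φ x)
  equal-kernels⇒unique-isomorphism A-refl h-hom h-surj h′-hom h′-surj ker⊆ ker⊇ =
    φ , φ-isIso , h′≈φ∘h , λ ψ ψ-isIso → φ-unique ψ (IsGroupIsomorphism.isGroupHomomorphism ψ-isIso)
    where
    open Factorisation A-refl h-hom h-surj h′-hom ker⊆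
    open GroupMorphisms rawGroup rawGroup using (module IsGroupIsomorphism)
    φ-isIso : IsIso rawGroup rawGroup φ
    φ-isIso = record
      { isGroupMonomorphism = record { isGroupHomomorphism = φ-isHom ; injective = φ-injective ker⊇ }
      ; surjective = φ-surjective h′-surj
      }

module _ {c ℓ} {Ṽ : Group c ℓ} {ι : Sign → Group.Carrier Ṽ} {π : Group.Carrier Ṽ → Λ}
         (ext : IsExtension Ṽ ι π) where
  open Group Ṽ
  open IsExtension ext
  private
    module Λ/2Λ = AbelianGroup Λ/2Λ
    module ι = GroupMorphisms.IsGroupHomomorphism ι-hom
    module π = GroupMorphisms.IsGroupHomomorphism π-hom

  lifts-differ-by-sign : ∀ x y → π x ≈V π y → ∃ λ s → y ≈ x ∙ ι s
  lifts-differ-by-sign x y πx≈πy = s , (begin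
    y                ≈⟨ //-rightDividesˡ x y ⟨
    (y ∙ x ⁻¹) ∙ x   ≈⟨ ∙-congʳ ιs≈y∙x⁻¹ ⟨
    ι s ∙ x          ≈⟨ ι-central s x ⟩
    x ∙ ι s          ∎)
    where
    open SetoidReasoning setoid
    open import Algebra.Properties.Group Ṽ using (//-rightDividesˡ)
    kernel-element : ∃ λ s → ι s ≈ y ∙ x ⁻¹
    kernel-element = Equivalence.to (exact (y ∙ x ⁻¹))
      (equal-images⇒x∙y⁻¹∈kernel Λ/2Λ.group π-hom y x (Λ/2Λ.sym {π x} {π y} πx≈πy))
    s : Sign
    s = proj₁ kernel-element
    ιs≈y∙x⁻¹ : ι s ≈ y ∙ x ⁻¹
    ιs≈y∙x⁻¹ = proj₂ kernel-element

  module _ {f : Word → Λ} {f̃ : Word → Carrier} (f̃-lift : ∀ w → π (f̃ w) ≈V f w) where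
    open SetoidReasoning Λ/2Λ.setoid

    lift-kernel⇒kernel : ∀ w → f̃ w ≈ ε → f w ≈V (λ _ → + 0)
    lift-kernel⇒kernel w f̃w≈ε = begin
      f w       ≈⟨ f̃-lift w ⟨
      π (f̃ w)   ≈⟨ π.⟦⟧-cong f̃w≈ε ⟩
      π ε       ≈⟨ π.ε-homo ⟩
      (λ _ → + 0) ∎

    lifts-have-equal-images : {f̃′ : Word → Carrier} → (∀ w → π (f̃′ w) ≈V f w) →
      ∀ w → π (f̃ w) ≈V π (f̃′ w)
    lifts-have-equal-images {f̃′} f̃′-lift w = begin
      π (f̃ w)   ≈⟨ f̃-lift w ⟩
      f w       ≈⟨ f̃′-lift w ⟨
      π (f̃′ w)  ∎

  ker-lift⊆ker-lift : {f : Word → Λ} → IsHom F₆ V f → IsSurj F₆ V f →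
    {f̃ f̃′ : Word → Carrier} →
    IsHom F₆ rawGroup f̃ → (∀ w → π (f̃ w) ≈V f w) →
    IsHom F₆ rawGroup f̃′ → (∀ w → π (f̃′ w) ≈V f w) →
    ∀ w → f̃ w ≈ ε → f̃′ w ≈ ε
  ker-lift⊆ker-lift {f} f-hom f-surj {f̃} {f̃′} f̃-hom f̃-lift f̃′-hom f̃′-lift w f̃w≈ε = begin
    f̃′ w                        ≈⟨ twist-by-parity Ṽ *-abelianGroup s*s≡+ ι-hom ι-central
                                     f̃-hom f̃′-hom t (proj₂ ∘ twist-on-generator) w ⟩
    f̃ w ∙ ι (⟦ parity w ⟧ t)    ≈⟨ ∙-cong f̃w≈ε (ι.⟦⟧-cong (≡.cong (λ x → ⟦ x ⟧ t) parity≡0)) ⟩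
    ε ∙ ι Sign.+                ≈⟨ identityˡ (ι Sign.+) ⟩
    ι Sign.+                    ≈⟨ ι.ε-homo ⟩
    ε                           ∎
    where
    open SetoidReasoning setoid
    open BitVectorEvaluation *-abelianGroup using (⟦_⟧)
    twist-on-generator : ∀ i → ∃ λ s → f̃′ (generator i) ≈ f̃ (generator i) ∙ ι s
    twist-on-generator i = lifts-differ-by-sign (f̃ (generator i)) (f̃′ (generator i))
      (lifts-have-equal-images f̃-lift f̃′-lift (generator i))
    t : Fin 6 → Sign
    t i = proj₁ (twist-on-generator i)
    parity≡0 : parity w ≡ replicate 6 false
    parity≡0 = parity-vanishes-on-kernel f-hom f-surj w (lift-kernel⇒kernel f̃-lift w f̃w≈ε)

lemma3p6 : ∀ {c ℓ : Level} (Ṽ : Group c ℓ)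
             (ι : Sign → Group.Carrier Ṽ) (π : Group.Carrier Ṽ → Λ) →
             IsExtension Ṽ ι π →
             (f : Word → Λ) → IsHom F₆ V f → IsSurj F₆ V f →
             (f̃ f̃′ : Word → Group.Carrier Ṽ) →
             IsHom F₆ (Group.rawGroup Ṽ) f̃ → IsSurj F₆ (Group.rawGroup Ṽ) f̃ →
             (∀ w → π (f̃ w) ≈V f w) →
             IsHom F₆ (Group.rawGroup Ṽ) f̃′ → IsSurj F₆ (Group.rawGroup Ṽ) f̃′ →
             (∀ w → π (f̃′ w) ≈V f w) →
             Σ (Group.Carrier Ṽ → Group.Carrier Ṽ) (λ φ →
               IsIso (Group.rawGroup Ṽ) (Group.rawGroup Ṽ) φ
               × (∀ w → Group._≈_ Ṽ (f̃′ w) (φ (f̃ w)))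
               × (∀ ψ → IsIso (Group.rawGroup Ṽ) (Group.rawGroup Ṽ) ψ →
                    (∀ w → Group._≈_ Ṽ (f̃′ w) (ψ (f̃ w))) →
                    ∀ x → Group._≈_ Ṽ (ψ x) (φ x)))
lemma3p6 Ṽ ι π ext f f-hom f-surj f̃ f̃′ f̃-hom f̃-surj f̃-lift f̃′-hom f̃′-surj f̃′-lift =
  equal-kernels⇒unique-isomorphism Ṽ ~refl f̃-hom f̃-surj f̃′-hom f̃′-surj
    (ker-lift⊆ker-lift ext f-hom f-surj f̃-hom f̃-lift f̃′-hom f̃′-lift)
    (ker-lift⊆ker-lift ext f-hom f-surj f̃′-hom f̃′-lift f̃-hom f̃-lift)
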